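{- Every graph $G$ satisfies $\chi_o(G)\le \gamma_e(G)+\chi(G)\le n_e(G)+\chi(G)$; moreover, if $G$ has no isolated vertices, then also $\gamma_e(G)+\chi(G)\le \gamma_t(G)+\chi(G)$, so that $\chi_o(G)\le\gamma_e(G)+\chi(G)\le\min\{n_e(G)+\chi(G),\gamma_t(G)+\chi(G)\}$.
   Context: All graphs are finite, simple and undirected. $\chi$ denotes the ordinary chromatic number. A set $S\subseteq V(G)$ is an even dominating set if every vertex $v$ of positive even degree in $G$ has a neighbor in $S$, i.e. $N_G(v)\cap S\neq\emptyset$; $\gamma_e(G)$ is the minimum size of an even dominating set. $n_e(G)$ is the number of non-isolated vertices of even degree in $G$. A set $S$ is a total dominating set if every vertex of $G$ has a neighbor in $S$; $\gamma_t(G)$ is its minimum size (defined for graphs without isolated vertices). A proper vertex coloring $\varphi$ of a graph $G$ is called an odd coloring if for every non-isolated vertex $x$ of $G$ there is a color $c$ such that the number of neighbors $y\in N(x)$ with $\varphi(y)=c$ is odd. The odd chromatic number $\chi_o(G)$ is the minimum number of colors in an odd coloring of $G$. -}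

module Defs where

open import Data.Nat using (ℕ; zero; suc; _+_; _≤_; _<_; _%_)
open import Data.Bool using (Bool; true; false; if_then_else_; _∧_)
open import Data.Fin using (Fin; zero; suc)
open import Data.Fin.Subset using (Subset; _∈_; ∣_∣)
open import Data.Product using (Σ; ∃; _×_; _,_)
open import Relation.Binary.PropositionalEquality using (_≡_; _≢_)
open import Relation.Nullary using (¬_)
open import Relation.Nullary.Decidable using (⌊_⌋)
open import Data.Fin using (_≟_)

record Graph : Set where
  field
    n     : ℕ
    adj   : Fin n → Fin n → Bool
    sym   : ∀ u v → adj u v ≡ adj v u
    irrefl : ∀ v → adj v v ≡ false
open Graph public

count : ∀ {m} → (Fin m → Bool) → ℕ
count {zero}  p = 0
count {suc m} p = (if p zero then 1 else 0) + count (λ i → p (suc i))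

Even : ℕ → Set
Even d = d % 2 ≡ 0

Odd : ℕ → Set
Odd d = d % 2 ≡ 1

deg : (G : Graph) → Fin (n G) → ℕ
deg G v = count (adj G v)

NonIsolated : (G : Graph) → Fin (n G) → Set
NonIsolated G v = 0 < deg G v

HasNoIsolated : Graph → Set
HasNoIsolated G = ∀ v → NonIsolated G v

IsMin : (ℕ → Set) → ℕ → Set
IsMin P m = P m × (∀ k → P k → m ≤ k)

Proper : (G : Graph) {k : ℕ} → (Fin (n G) → Fin k) → Set
Proper G φ = ∀ u v → adj G u v ≡ true → φ u ≢ φ v

Colorable : Graph → ℕ → Set
Colorable G k = Σ (Fin (n G) → Fin k) λ φ → Proper G φ

ChromaticNumber : Graph → ℕ → Set
ChromaticNumber G = IsMin (Colorable G)

IsOddColoring : (G : Graph) {k : ℕ} → (Fin (n G) → Fin k) → Set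
IsOddColoring G {k} φ =
  Proper G φ ×
  (∀ x → NonIsolated G x →
     ∃ λ (c : Fin k) → Odd (count (λ y → adj G x y ∧ ⌊ φ y ≟ c ⌋)))

OddColorable : Graph → ℕ → Set
OddColorable G k = Σ (Fin (n G) → Fin k) λ φ → IsOddColoring G φ

OddChromaticNumber : Graph → ℕ → Set
OddChromaticNumber G = IsMin (OddColorable G)

IsEvenDominating : (G : Graph) → Subset (n G) → Set
IsEvenDominating G S =
  ∀ v → NonIsolated G v → Even (deg G v) →
    ∃ λ u → adj G v u ≡ true × u ∈ S

HasEvenDomSetOfSize : Graph → ℕ → Set
HasEvenDomSetOfSize G k = Σ (Subset (n G)) λ S → IsEvenDominating G S × ∣ S ∣ ≡ k

EvenDominationNumber : Graph → ℕ → Set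
EvenDominationNumber G = IsMin (HasEvenDomSetOfSize G)

IsTotalDominating : (G : Graph) → Subset (n G) → Set
IsTotalDominating G S = ∀ v → ∃ λ u → adj G v u ≡ true × u ∈ S

HasTotalDomSetOfSize : Graph → ℕ → Set
HasTotalDomSetOfSize G k = Σ (Subset (n G)) λ S → IsTotalDominating G S × ∣ S ∣ ≡ k

TotalDominationNumber : Graph → ℕ → Set
TotalDominationNumber G = IsMin (HasTotalDomSetOfSize G)

isPosEven : ℕ → Bool
isPosEven zero = false
isPosEven (suc d) = ⌊ Data.Nat._≟_ ((suc d) % 2) 0 ⌋

nₑ : Graph → ℕ
nₑ G = count (λ v → isPosEven (deg G v))

{-# OPTIONS --safe #-}
-- Give every vertex of an even dominating set S its own new colour and keep a proper
-- χ-colouring elsewhere; the result is proper. A vertex of odd degree sees some colour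
-- an odd number of times, since its degree is the sum of the sizes of its colour classes;
-- a non-isolated vertex of even degree has a neighbour in S, whose colour it sees exactly
-- once. For the other bounds: one chosen neighbour of each non-isolated
-- even-degree vertex forms an even dominating set, and total dominating sets are even
-- dominating.
module Submission where

open import Defs hiding (sym)
open import Data.Nat using (ℕ; zero; suc; _+_; _≤_; _<_; _%_; z≤n; s≤s)
open import Data.Nat.Properties
  using (≤-trans; ≤-refl; ≤-reflexive; +-suc; +-mono-≤; m≤m+n; n≤1+n; <⇒≱)
open import Data.Nat.DivMod using (%-distribˡ-+; m%n<n; m%n%n≡m%n)
open import Data.Bool using (Bool; true; false; _∧_; not)
open import Data.Bool.Properties using (∧-zeroʳ; ∧-identityʳ)
open import Data.Fin using (Fin; zero; suc; _↑ʳ_; toℕ; pinch)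
open import Data.Fin.Properties using (_≟_; ↑ʳ-injective; suc-injective; toℕ-↑ʳ)
open import Data.Fin.Subset using (Subset; inside; outside; _∈_; _∉_; ∣_∣; ⊥; ⁅_⁆; _∪_)
open import Data.Fin.Subset.Properties using (_∈?_; p⊆p∪q; q⊆p∪q; ∣⊥∣≡0; ∣⁅x⁆∣≡1; x∈⁅x⁆)
open import Data.Vec using (_∷_; [])
open import Data.Vec.Base using (here; there)
open import Data.Product using (_×_; _,_; Σ; ∃)
open import Data.Sum using (_⊎_; inj₁; inj₂)
open import Function using (_∘_)
open import Relation.Binary.PropositionalEquality
  using (_≡_; _≢_; refl; sym; trans; cong; cong₂; subst; module ≡-Reasoning)
open import Relation.Nullary using (yes; no; contradiction)
open import Relation.Nullary.Decidable using (⌊_⌋; isYes≗does; dec-true; dec-false; ⌊⌋-map′)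
import Data.Nat as ℕ

⌊≟⌋-refl : ∀ {k} (x : Fin k) → ⌊ x ≟ x ⌋ ≡ true
⌊≟⌋-refl x = trans (isYes≗does (x ≟ x)) (dec-true (x ≟ x) refl)

⌊≟⌋-≢ : ∀ {k} {x y : Fin k} → x ≢ y → ⌊ x ≟ y ⌋ ≡ false
⌊≟⌋-≢ {x = x} {y} x≢y = trans (isYes≗does (x ≟ y)) (dec-false (x ≟ y) x≢y)

⌊suc≟suc⌋ : ∀ {k} (x y : Fin k) → ⌊ suc x ≟ suc y ⌋ ≡ ⌊ x ≟ y ⌋
⌊suc≟suc⌋ x y = ⌊⌋-map′ _ _ (x ≟ y)

count-cong : ∀ {m} {p q : Fin m → Bool} → (∀ i → p i ≡ q i) → count p ≡ count q
count-cong {zero}  p≗q = refl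
count-cong {suc m} p≗q rewrite p≗q zero = cong (_ +_) (count-cong (p≗q ∘ suc))

count-false : ∀ {m} → count {m} (λ _ → false) ≡ 0
count-false {zero}  = refl
count-false {suc m} = count-false {m}

count-∧-split : ∀ {m} (p g : Fin m → Bool) →
  count p ≡ count (λ i → p i ∧ g i) + count (λ i → p i ∧ not (g i))
count-∧-split {zero}  p g = refl
count-∧-split {suc m} p g with p zero | g zero
... | true  | true  = cong suc (count-∧-split (p ∘ suc) (g ∘ suc))
... | true  | false = trans (cong suc (count-∧-split (p ∘ suc) (g ∘ suc))) (sym (+-suc _ _))
... | false | _     = count-∧-split (p ∘ suc) (g ∘ suc)

0<count⇒∃ : ∀ {m} (p : Fin m → Bool) → 0 < count p → ∃ λ i → p i ≡ true
0<count⇒∃ {suc m} p 0<c with p zero in eq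
... | true  = zero , eq
... | false with 0<count⇒∃ (p ∘ suc) 0<c
...   | i , pi = suc i , pi

count-≟ : ∀ {m} (u : Fin m) → count (λ y → ⌊ y ≟ u ⌋) ≡ 1
count-≟ {suc m} zero    = cong suc (count-false {m})
count-≟ {suc m} (suc u) = trans (count-cong (λ y → ⌊suc≟suc⌋ y u)) (count-≟ u)

%2≡0⊎%2≡1 : ∀ a → a % 2 ≡ 0 ⊎ a % 2 ≡ 1
%2≡0⊎%2≡1 a with a % 2 | m%n<n a 2
... | 0           | _               = inj₁ refl
... | 1           | _               = inj₂ refl
... | suc (suc _) | s≤s (s≤s ())

odd-+ : ∀ a b → Odd (a + b) → Odd a ⊎ Odd b
odd-+ a b odd with %2≡0⊎%2≡1 a
... | inj₂ a-odd  = inj₁ a-odd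
... | inj₁ a-even = inj₂ (begin
  b % 2                 ≡⟨ sym (m%n%n≡m%n b 2) ⟩
  (0 + b % 2) % 2       ≡⟨ cong (λ r → (r + b % 2) % 2) (sym a-even) ⟩
  (a % 2 + b % 2) % 2   ≡⟨ sym (%-distribˡ-+ a b 2) ⟩
  (a + b) % 2           ≡⟨ odd ⟩
  1                     ∎)
  where open ≡-Reasoning

odd-count-∧-split : ∀ {m} (p g : Fin m → Bool) → Odd (count p) →
  Odd (count (λ i → p i ∧ g i)) ⊎ Odd (count (λ i → p i ∧ not (g i)))
odd-count-∧-split p g odd =
  odd-+ (count (λ i → p i ∧ g i)) (count (λ i → p i ∧ not (g i)))
        (subst Odd (count-∧-split p g) odd)

odd⇒0< : ∀ {d} → Odd d → 0 < d
odd⇒0< {suc d} _ = s≤s z≤n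

odd-class-suc : ∀ {m} k (p : Fin m → Bool) (φ : Fin m → Fin (suc k)) → Odd (count p) →
  ∃ λ c → Odd (count (λ y → p y ∧ ⌊ φ y ≟ c ⌋))
odd-class-suc zero p φ odd = zero , subst Odd (count-cong only-colour) odd
  where
  only-colour : ∀ y → p y ≡ (p y ∧ ⌊ φ y ≟ zero ⌋)
  only-colour y with φ y
  ... | zero = sym (∧-identityʳ (p y))
odd-class-suc (suc k) p φ odd
  with odd-count-∧-split p (λ y → ⌊ φ y ≟ zero ⌋) odd
... | inj₁ zero-odd = zero , zero-odd
... | inj₂ rest-odd with odd-class-suc k _ (pinch zero ∘ φ) rest-odd
...   | c , c-odd = suc c , subst Odd (count-cong rest-class) c-odd
  where
  rest-class : ∀ y → ((p y ∧ not ⌊ φ y ≟ zero ⌋) ∧ ⌊ pinch zero (φ y) ≟ c ⌋)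
                     ≡ (p y ∧ ⌊ φ y ≟ suc c ⌋)
  rest-class y with φ y
  ... | zero  = trans (cong (_∧ _) (∧-zeroʳ (p y))) (sym (∧-zeroʳ (p y)))
  ... | suc d = cong₂ _∧_ (∧-identityʳ (p y)) (sym (⌊suc≟suc⌋ d c))

odd-class : ∀ {m k} (p : Fin m → Bool) (φ : Fin m → Fin k) → Odd (count p) →
  ∃ λ c → Odd (count (λ y → p y ∧ ⌊ φ y ≟ c ⌋))
odd-class {k = suc k} p φ odd = odd-class-suc k p φ odd
odd-class {k = zero}  p φ odd with 0<count⇒∃ p (odd⇒0< odd)
... | i , _ with φ i
...   | ()

recolour : ∀ {m χ} (S : Subset m) → (Fin m → Fin χ) → Fin m → Fin (∣ S ∣ + χ)
recolour (inside  ∷ S) φ zero    = zero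
recolour (inside  ∷ S) φ (suc u) = suc (recolour S (φ ∘ suc) u)
recolour (outside ∷ S) φ zero    = ∣ S ∣ ↑ʳ φ zero
recolour (outside ∷ S) φ (suc u) = recolour S (φ ∘ suc) u

recolour-∉ : ∀ {m χ} (S : Subset m) (φ : Fin m → Fin χ) {u} → u ∉ S →
  recolour S φ u ≡ ∣ S ∣ ↑ʳ φ u
recolour-∉ (inside  ∷ S) φ {zero}  u∉S = contradiction here u∉S
recolour-∉ (inside  ∷ S) φ {suc u} u∉S = cong suc (recolour-∉ S (φ ∘ suc) (u∉S ∘ there))
recolour-∉ (outside ∷ S) φ {zero}  u∉S = refl
recolour-∉ (outside ∷ S) φ {suc u} u∉S = recolour-∉ S (φ ∘ suc) (u∉S ∘ there)

recolour-∈-< : ∀ {m χ} (S : Subset m) (φ : Fin m → Fin χ) {u} → u ∈ S →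
  toℕ (recolour S φ u) < ∣ S ∣
recolour-∈-< (inside  ∷ S) φ here        = s≤s z≤n
recolour-∈-< (inside  ∷ S) φ (there u∈S) = s≤s (recolour-∈-< S (φ ∘ suc) u∈S)
recolour-∈-< (outside ∷ S) φ (there u∈S) = recolour-∈-< S (φ ∘ suc) u∈S

recolour-∈-unique : ∀ {m χ} (S : Subset m) (φ : Fin m → Fin χ) {u v} → u ∈ S →
  recolour S φ u ≡ recolour S φ v → u ≡ v
recolour-∈-unique (inside  ∷ S) φ {zero}  {zero}  here        eq = refl
recolour-∈-unique (inside  ∷ S) φ {suc u} {suc v} (there u∈S) eq =
  cong suc (recolour-∈-unique S (φ ∘ suc) u∈S (suc-injective eq))
recolour-∈-unique (outside ∷ S) φ {suc u} {suc v} (there u∈S) eq =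
  cong suc (recolour-∈-unique S (φ ∘ suc) u∈S eq)
recolour-∈-unique (outside ∷ S) φ {suc u} {zero}  (there u∈S) eq =
  contradiction (begin
    ∣ S ∣                          ≤⟨ m≤m+n ∣ S ∣ (toℕ (φ zero)) ⟩
    ∣ S ∣ + toℕ (φ zero)           ≡⟨ sym (toℕ-↑ʳ ∣ S ∣ (φ zero)) ⟩
    toℕ (∣ S ∣ ↑ʳ φ zero)          ≡⟨ cong toℕ (sym eq) ⟩
    toℕ (recolour S (φ ∘ suc) u)   ∎)
  (<⇒≱ (recolour-∈-< S (φ ∘ suc) u∈S))
  where open Data.Nat.Properties.≤-Reasoning

module _ (G : Graph) {χ : ℕ} (S : Subset (n G)) (φ : Fin (n G) → Fin χ) where

  private
    ψ : Fin (n G) → Fin (∣ S ∣ + χ)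
    ψ = recolour S φ

    no-loop : ∀ {u v} → adj G u v ≡ true → u ≢ v
    no-loop {u} uv refl with trans (sym uv) (irrefl G u)
    ... | ()

  recolour-proper : Proper G φ → Proper G ψ
  recolour-proper φ-proper u v uv ψu≡ψv with u ∈? S | v ∈? S
  ... | yes u∈S | _       = no-loop uv (recolour-∈-unique S φ u∈S ψu≡ψv)
  ... | no _    | yes v∈S = no-loop uv (sym (recolour-∈-unique S φ v∈S (sym ψu≡ψv)))
  ... | no u∉S  | no v∉S  = φ-proper u v uv (↑ʳ-injective ∣ S ∣ (φ u) (φ v) (begin
    ∣ S ∣ ↑ʳ φ u   ≡⟨ sym (recolour-∉ S φ u∉S) ⟩
    ψ u            ≡⟨ ψu≡ψv ⟩
    ψ v            ≡⟨ recolour-∉ S φ v∉S ⟩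
    ∣ S ∣ ↑ʳ φ v   ∎))
    where open ≡-Reasoning

  sees-once : ∀ {x u} → adj G x u ≡ true → u ∈ S →
    count (λ y → adj G x y ∧ ⌊ ψ y ≟ ψ u ⌋) ≡ 1
  sees-once {x} {u} xu u∈S = trans (count-cong only-u) (count-≟ u)
    where
    only-u : ∀ y → (adj G x y ∧ ⌊ ψ y ≟ ψ u ⌋) ≡ ⌊ y ≟ u ⌋
    only-u y with y ≟ u
    ... | yes refl rewrite xu = ⌊≟⌋-refl (ψ u)
    ... | no y≢u =
      trans (cong (adj G x y ∧_) (⌊≟⌋-≢ (y≢u ∘ sym ∘ recolour-∈-unique S φ u∈S ∘ sym)))
            (∧-zeroʳ (adj G x y))

  recolour-isOddColoring : IsEvenDominating G S → Proper G φ → IsOddColoring G ψ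
  recolour-isOddColoring S-dom φ-proper = recolour-proper φ-proper , odd-class-at
    where
    odd-class-at : ∀ x → NonIsolated G x → ∃ λ c → Odd (count (λ y → adj G x y ∧ ⌊ ψ y ≟ c ⌋))
    odd-class-at x x-nonisolated with %2≡0⊎%2≡1 (deg G x)
    ... | inj₂ odd  = odd-class (adj G x) ψ odd
    ... | inj₁ even with S-dom x x-nonisolated even
    ...   | u , xu , u∈S = ψ u , subst Odd (sym (sees-once xu u∈S)) refl

∣p∪q∣≤∣p∣+∣q∣ : ∀ {k} (p q : Subset k) → ∣ p ∪ q ∣ ≤ ∣ p ∣ + ∣ q ∣
∣p∪q∣≤∣p∣+∣q∣ []            []            = z≤n
∣p∪q∣≤∣p∣+∣q∣ (inside  ∷ p) (inside  ∷ q) =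
  s≤s (≤-trans (∣p∪q∣≤∣p∣+∣q∣ p q) (≤-trans (n≤1+n _) (≤-reflexive (sym (+-suc _ _)))))
∣p∪q∣≤∣p∣+∣q∣ (inside  ∷ p) (outside ∷ q) = s≤s (∣p∪q∣≤∣p∣+∣q∣ p q)
∣p∪q∣≤∣p∣+∣q∣ (outside ∷ p) (inside  ∷ q) =
  ≤-trans (s≤s (∣p∪q∣≤∣p∣+∣q∣ p q)) (≤-reflexive (sym (+-suc _ _)))
∣p∪q∣≤∣p∣+∣q∣ (outside ∷ p) (outside ∷ q) = ∣p∪q∣≤∣p∣+∣q∣ p q

witness-set : ∀ {m k} (b : Fin m → Bool) (R : Fin m → Fin k → Set) →
  (∀ i → b i ≡ true → ∃ (R i)) →
  Σ (Subset k) λ W → ∣ W ∣ ≤ count b × (∀ i → b i ≡ true → ∃ λ u → R i u × u ∈ W)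
witness-set {zero} {k} b R wit = ⊥ , ≤-reflexive (∣⊥∣≡0 k) , λ ()
witness-set {suc m} b R wit with witness-set (b ∘ suc) (R ∘ suc) (wit ∘ suc)
... | W , ∣W∣≤ , hits with b zero in b₀
...   | false = W , ∣W∣≤ , hits′
  where
  hits′ : ∀ i → b i ≡ true → ∃ λ v → R i v × v ∈ W
  hits′ zero    b₀′ = contradiction (trans (sym b₀) b₀′) λ ()
  hits′ (suc i)     = hits i
...   | true with wit zero b₀
...     | u , r = ⁅ u ⁆ ∪ W , size , hits′
  where
  size : ∣ ⁅ u ⁆ ∪ W ∣ ≤ suc (count (b ∘ suc))
  size = ≤-trans (∣p∪q∣≤∣p∣+∣q∣ ⁅ u ⁆ W)
                 (≤-trans (≤-reflexive (cong (_+ ∣ W ∣) (∣⁅x⁆∣≡1 u))) (s≤s ∣W∣≤))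
  hits′ : ∀ i → b i ≡ true → ∃ λ v → R i v × v ∈ ⁅ u ⁆ ∪ W
  hits′ zero    _  = u , r , p⊆p∪q W (x∈⁅x⁆ u)
  hits′ (suc i) bi with hits i bi
  ... | v , rv , v∈W = v , rv , q⊆p∪q ⁅ u ⁆ W v∈W

isPosEven⇒0< : ∀ {d} → isPosEven d ≡ true → 0 < d
isPosEven⇒0< {suc d} _ = s≤s z≤n

0<∧Even⇒isPosEven : ∀ {d} → 0 < d → Even d → isPosEven d ≡ true
0<∧Even⇒isPosEven {suc d} _ even = trans (isYes≗does _) (dec-true (suc d % 2 ℕ.≟ 0) even)

evenDominatingSet-≤-nₑ : (G : Graph) →
  Σ (Subset (n G)) λ S → IsEvenDominating G S × ∣ S ∣ ≤ nₑ G
evenDominatingSet-≤-nₑ G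
  with witness-set (λ v → isPosEven (deg G v)) (λ v u → adj G v u ≡ true)
                   (λ v pe → 0<count⇒∃ (adj G v) (isPosEven⇒0< pe))
... | S , ∣S∣≤nₑ , hits =
  S , (λ v 0<deg even → hits v (0<∧Even⇒isPosEven 0<deg even)) , ∣S∣≤nₑ

totalDominating⇒evenDominating : ∀ G {S} → IsTotalDominating G S → IsEvenDominating G S
totalDominating⇒evenDominating G S-tot v _ _ = S-tot v

mainTheorem9 : (G : Graph) (χ χₒ γₑ : ℕ) →
    ChromaticNumber G χ → OddChromaticNumber G χₒ → EvenDominationNumber G γₑ →
    (χₒ ≤ γₑ + χ) × (γₑ + χ ≤ nₑ G + χ) ×
    (HasNoIsolated G → (γₜ : ℕ) → TotalDominationNumber G γₜ → γₑ + χ ≤ γₜ + χ)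
mainTheorem9 G χ χₒ γₑ ((φ , φ-proper) , _) (_ , χₒ-min) ((S , S-dom , ∣S∣≡γₑ) , γₑ-min) =
  -- A total dominating set already forces the absence of isolated vertices.
  χₒ≤γₑ+χ , +-mono-≤ γₑ≤nₑ ≤-refl , λ _ γₜ γₜ-min → +-mono-≤ (γₑ≤γₜ γₜ γₜ-min) ≤-refl
  where
  χₒ≤γₑ+χ : χₒ ≤ γₑ + χ
  χₒ≤γₑ+χ = χₒ-min (γₑ + χ) (subst (λ s → OddColorable G (s + χ)) ∣S∣≡γₑ
                               (recolour S φ , recolour-isOddColoring G S φ S-dom φ-proper))
  γₑ≤nₑ : γₑ ≤ nₑ G
  γₑ≤nₑ with evenDominatingSet-≤-nₑ G
  ... | T , T-dom , ∣T∣≤nₑ = ≤-trans (γₑ-min ∣ T ∣ (T , T-dom , refl)) ∣T∣≤nₑ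
  γₑ≤γₜ : (γₜ : ℕ) → TotalDominationNumber G γₜ → γₑ ≤ γₜ
  γₑ≤γₜ γₜ ((T , T-tot , ∣T∣≡γₜ) , _) =
    γₑ-min γₜ (T , totalDominating⇒evenDominating G T-tot , ∣T∣≡γₜ)
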